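{- Let $w$ be an irreducible packed word and let $u,v$ be packed words with $v\ne\varepsilon$ and $w=u\triangleleft_B v$. Then $(u,v)$ is the blue-factorization of $w$ if and only if $v$ is blue-irreducible.
   Context: Words over positive integers; $|w|$ length, $\max(w)$ largest letter ($\max(\varepsilon)=0$), $w^{[k]}$ adds $k$ to every letter. Packed: every integer $1..\max(w)$ occurs. $u\odot v=u^{[\max(v)]}\cdot v$. A global descent of $w$ of length $n$ is $c$, $1\le c\le n-1$, with every letter of $w_1..w_c$ strictly greater than every letter of $w_{c+1}..w_n$; irreducible = nonempty with no global descent. For packed $w$: $\psi_{i^\circ}(w)$ ($1\le i\le\max(w)+1$) adds $1$ to each letter $\ge i$ and appends the letter $i$; $\psi_{i^\bullet}(w)=w\cdot i$ ($1\le i\le\max(w)$). Every nonempty packed $v$ is uniquely $\psi_{i^\alpha}(v')$ with $v'$ packed, $\alpha\in\{\circ,\bullet\}$. For packed $u$ and nonempty packed $v=\psi_{i^\alpha}(v')$, $u\triangleleft_B v=\psi_{(i+\max(u))^\alpha}(v'\odot u)$. The blue-factorization of irreducible $w$ is the unique pair $(u,v)$ of packed words with $v\neq\varepsilon$, $w=u\triangleleft_B v$ and $|u|$ maximal. $v$ is blue-irreducible if it is irreducible and $v=x\triangleleft_B y$ with $y\ne\varepsilon$ implies $x=\varepsilon$. -}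

module Defs where

open import Data.Nat using (ℕ; zero; suc; _+_; _≤_; _<_; _⊔_; _≤ᵇ_)
open import Data.Bool using (if_then_else_)
open import Data.List using (List; []; _∷_; _++_; map; foldr; take; drop; length; [_])
open import Data.List.Membership.Propositional using (_∈_)
open import Data.List.Relation.Unary.All using (All)
open import Data.Product using (Σ; ∃; ∃-syntax; _×_; _,_)
open import Relation.Nullary using (¬_)
open import Relation.Binary.PropositionalEquality using (_≡_; _≢_)

-- words over positive integers, represented as lists of naturals
Word : Set
Word = List ℕ

-- max(w), with max(ε) = 0
maxW : Word → ℕ
maxW = foldr _⊔_ 0

shift : ℕ → Word → Word
shift k = map (k +_)

Packed : Word → Set
Packed w = All (1 ≤_) w × (∀ k → 1 ≤ k → k ≤ maxW w → k ∈ w)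

_⊙_ : Word → Word → Word
u ⊙ v = shift (maxW v) u ++ v

GlobalDescent : Word → ℕ → Set
GlobalDescent w c =
  1 ≤ c × suc c ≤ length w ×
  (∀ a b → a ∈ take c w → b ∈ drop c w → b < a)

Irreducible : Word → Set
Irreducible w = w ≢ [] × ¬ (∃[ c ] GlobalDescent w c)

data Color : Set where
  circ bullet : Color

psi : Color → ℕ → Word → Word
psi circ i w = map (λ a → if i ≤ᵇ a then suc a else a) w ++ [ i ]
psi bullet i w = w ++ [ i ]

ValidIdx : Color → ℕ → Word → Set
ValidIdx circ i w = 1 ≤ i × i ≤ suc (maxW w)
ValidIdx bullet i w = 1 ≤ i × i ≤ maxW w

-- TriB u v w  means  w = u ◁_B v  (for packed u and nonempty packed v):
-- writing v = ψ_{i^α}(v') (v' packed; this decomposition is unique),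
-- w = ψ_{(i+max u)^α}(v' ⊙ u).
TriB : Word → Word → Word → Set
TriB u v w =
  Σ Color λ α → Σ ℕ λ i → Σ Word λ v' →
    Packed v' × ValidIdx α i v' × v ≡ psi α i v' ×
    w ≡ psi α (i + maxW u) (v' ⊙ u)

BlueFactorization : Word → Word → Word → Set
BlueFactorization w u v =
  Packed u × Packed v × v ≢ [] × TriB u v w ×
  (∀ u' v' → Packed u' → Packed v' → v' ≢ [] → TriB u' v' w →
     length u' ≤ length u)

BlueIrreducible : Word → Set
BlueIrreducible v =
  Irreducible v ×
  (∀ x y → Packed x → Packed y → y ≢ [] → TriB x y v → x ≡ [])

{-# OPTIONS --safe #-}
-- Unfolding ψ, w = u ◁_B v says: v = P·i and w = P^[max u]·u·(i + max u), because
-- the ψ step at index i + max u leaves the letters of u alone and commutes with the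
-- shift of v'. In this form ◁_B is associative, (x ⊙ u) ◁_B y = u ◁_B (x ◁_B y), and
-- any factorization w = u' ◁_B v' with |u'| ≥ |u| is of the form u' = x ⊙ u,
-- v = x ◁_B v'. So the left factor u can be enlarged exactly when v has a nonempty
-- left factor, and a global descent of v = P·i lifts to one of w.
module Submission where

open import Defs
open import Data.List using ([])
open import Relation.Binary.PropositionalEquality using (_≢_)
open import Function.Bundles using (_⇔_)

open import Data.Nat using (ℕ; zero; suc; _+_; _∸_; _≤_; _<_; _⊔_; _≤ᵇ_; z≤n; s≤s; s≤s⁻¹; _≤?_)
open import Data.Nat.Properties
open import Data.Bool using (true; false; if_then_else_; T)
open import Data.Unit using (tt)
open import Data.List using (List; _∷_; _++_; map; take; drop; length; [_])
open import Data.List.Properties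
  using (map-id; map-id-local; map-++; map-∘; map-cong; map-injective; ++-assoc;
         length-++; length-map; length-++-≤ʳ; take-map; drop-map; ∷-injective; ∷ʳ-injective)
open import Data.List.Membership.Propositional using (_∈_)
open import Data.List.Membership.Propositional.Properties using (∈-map⁺; ∈-map⁻; ∈-++⁺ˡ; ∈-++⁺ʳ; ∈-++⁻)
open import Data.List.Relation.Unary.All as All using (All)
import Data.List.Relation.Unary.All.Properties as All
open import Data.List.Relation.Unary.Any using (here; there)
open import Data.Product using (Σ; _×_; _,_; proj₁; map₂)
open import Data.Sum using (inj₁; inj₂)
open import Function using (_∘_)
open import Relation.Nullary using (yes; no; contradiction)
open import Relation.Binary.PropositionalEquality using (_≡_; refl; sym; trans; cong; cong₂; subst; module ≡-Reasoning)
open import Function.Bundles using (mk⇔)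

private
  variable
    A B : Set

++-∷ʳ-injective : ∀ (xs ys xs′ ys′ : List A) {a b} →
  xs ++ ys ++ [ a ] ≡ xs′ ++ ys′ ++ [ b ] → xs ++ ys ≡ xs′ ++ ys′ × a ≡ b
++-∷ʳ-injective xs ys xs′ ys′ {a} {b} eq = ∷ʳ-injective (xs ++ ys) (xs′ ++ ys′)
  (trans (++-assoc xs ys [ a ]) (trans eq (sym (++-assoc xs′ ys′ [ b ]))))

++-≡-++⁻ : ∀ (xs ys us vs : List A) → xs ++ us ≡ ys ++ vs → length us ≤ length vs →
  Σ (List A) λ zs → vs ≡ zs ++ us × xs ≡ ys ++ zs
++-≡-++⁻ []       []       us vs eq _  = [] , sym eq , refl
++-≡-++⁻ []       (y ∷ ys) us vs eq le =
  contradiction (subst (λ zs → length zs ≤ length vs) eq le) (<⇒≱ (s≤s (length-++-≤ʳ vs {ys})))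
++-≡-++⁻ (x ∷ xs) []       us vs eq _  = x ∷ xs , sym eq , refl
++-≡-++⁻ (x ∷ xs) (y ∷ ys) us vs eq le with ∷-injective eq
... | refl , eq′ with ++-≡-++⁻ xs ys us vs eq′ le
... | zs , vs≡ , xs≡ = zs , vs≡ , cong (x ∷_) xs≡

map-≡-++⁻ : ∀ (f : A → B) xs ys zs → map f xs ≡ ys ++ zs →
  Σ (List A) λ ys′ → Σ (List A) λ zs′ → xs ≡ ys′ ++ zs′ × map f ys′ ≡ ys × map f zs′ ≡ zs
map-≡-++⁻ f xs       []       zs eq = [] , xs , refl , refl , eq
map-≡-++⁻ f (x ∷ xs) (y ∷ ys) zs eq with ∷-injective eq
... | fx≡y , eq′ with map-≡-++⁻ f xs ys zs eq′
... | ys′ , zs′ , xs≡ , eqˡ , eqʳ = x ∷ ys′ , zs′ , cong (x ∷_) xs≡ , cong₂ _∷_ fx≡y eqˡ , eqʳ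

take-++ˡ : ∀ n (xs ys : List A) → n ≤ length xs → take n (xs ++ ys) ≡ take n xs
take-++ˡ zero    xs       ys _         = refl
take-++ˡ (suc n) (x ∷ xs) ys (s≤s le) = cong (x ∷_) (take-++ˡ n xs ys le)

drop-++ˡ : ∀ n (xs ys : List A) → n ≤ length xs → drop n (xs ++ ys) ≡ drop n xs ++ ys
drop-++ˡ zero    xs       ys _         = refl
drop-++ˡ (suc n) (x ∷ xs) ys (s≤s le) = drop-++ˡ n xs ys le

suc-length≤length-++-∷ʳ : ∀ (xs ys : List A) y → suc (length xs) ≤ length (xs ++ ys ++ [ y ])
suc-length≤length-++-∷ʳ []       ys y = subst (1 ≤_) (sym (length-++ ys)) (m≤n+m 1 (length ys))
suc-length≤length-++-∷ʳ (x ∷ xs) ys y = s≤s (suc-length≤length-++-∷ʳ xs ys y)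

shift-injective : ∀ k {xs ys} → shift k xs ≡ shift k ys → xs ≡ ys
shift-injective k = map-injective (+-cancelˡ-≡ k _ _)

shift-shift : ∀ a b xs → shift a (shift b xs) ≡ shift (a + b) xs
shift-shift a b xs = trans (sym (map-∘ xs)) (map-cong (λ x → sym (+-assoc a b x)) xs)

∈⇒≤maxW : ∀ {a xs} → a ∈ xs → a ≤ maxW xs
∈⇒≤maxW {xs = x ∷ xs} (here refl) = m≤m⊔n x (maxW xs)
∈⇒≤maxW {xs = x ∷ xs} (there p) = ≤-trans (∈⇒≤maxW p) (m≤n⊔m x (maxW xs))

maxW-++ : ∀ xs ys → maxW (xs ++ ys) ≡ maxW xs ⊔ maxW ys
maxW-++ []       ys = refl
maxW-++ (x ∷ xs) ys = trans (cong (x ⊔_) (maxW-++ xs ys)) (sym (⊔-assoc x (maxW xs) (maxW ys)))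

maxW-shift-⊔ : ∀ k xs → maxW (shift k xs) ⊔ k ≡ k + maxW xs
maxW-shift-⊔ k []       = sym (+-identityʳ k)
maxW-shift-⊔ k (x ∷ xs) = begin
  (k + x) ⊔ maxW (shift k xs) ⊔ k   ≡⟨ ⊔-assoc (k + x) _ k ⟩
  (k + x) ⊔ (maxW (shift k xs) ⊔ k) ≡⟨ cong ((k + x) ⊔_) (maxW-shift-⊔ k xs) ⟩
  (k + x) ⊔ (k + maxW xs)           ≡⟨ +-distribˡ-⊔ k x (maxW xs) ⟨
  k + (x ⊔ maxW xs)                 ∎
  where open ≡-Reasoning

maxW-⊙ : ∀ x u → maxW (x ⊙ u) ≡ maxW u + maxW x
maxW-⊙ x u = trans (maxW-++ (shift (maxW u) x) u) (maxW-shift-⊔ (maxW u) x)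

length-⊙ : ∀ x u → length (x ⊙ u) ≡ length x + length u
length-⊙ x u = trans (length-++ (shift (maxW u) x)) (cong (_+ length u) (length-map _ x))

length-⊙≤⇒≡[] : ∀ x u → length (x ⊙ u) ≤ length u → x ≡ []
length-⊙≤⇒≡[] []      u _  = refl
length-⊙≤⇒≡[] (a ∷ x) u le = contradiction le (<⇒≱ (s≤s (length-++-≤ʳ u {shift (maxW u) x})))

packed-⊙⁺ : ∀ {x u} → Packed x → Packed u → Packed (x ⊙ u)
packed-⊙⁺ {x} {u} (x≥1 , x-covers) (u≥1 , u-covers) =
  All.++⁺ (All.map⁺ (All.map (λ a≥1 → ≤-trans a≥1 (m≤n+m _ (maxW u))) x≥1)) u≥1 , covers
  where
  m = maxW u
  covers : ∀ k → 1 ≤ k → k ≤ maxW (x ⊙ u) → k ∈ x ⊙ u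
  covers k k≥1 k≤max with k ≤? m
  ... | yes k≤m = ∈-++⁺ʳ (shift m x) (u-covers k k≥1 k≤m)
  ... | no k≰m = subst (_∈ x ⊙ u) (m+[n∸m]≡n (<⇒≤ m<k))
                   (∈-++⁺ˡ (∈-map⁺ (m +_) (x-covers (k ∸ m) (m<n⇒0<n∸m m<k) k∸m≤max)))
    where
    m<k = ≰⇒> k≰m
    k∸m≤max : k ∸ m ≤ maxW x
    k∸m≤max = subst (k ∸ m ≤_) (m+n∸m≡n m (maxW x)) (∸-monoˡ-≤ m (subst (k ≤_) (maxW-⊙ x u) k≤max))

-- Positivity of the letters of x cannot be read off x ⊙ u, whose letters are shifted.
packed-⊙⁻ˡ : ∀ {x u} → All (1 ≤_) x → Packed (x ⊙ u) → Packed x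
packed-⊙⁻ˡ {x} {u} x≥1 (_ , ⊙-covers) = x≥1 , covers
  where
  m = maxW u
  covers : ∀ k → 1 ≤ k → k ≤ maxW x → k ∈ x
  covers k k≥1 k≤max with ∈-++⁻ (shift m x)
    (⊙-covers (m + k) (≤-trans k≥1 (m≤n+m k m)) (subst (m + k ≤_) (sym (maxW-⊙ x u)) (+-monoʳ-≤ m k≤max)))
  ... | inj₁ m+k∈ with ∈-map⁻ (m +_) m+k∈
  ...   | a , a∈x , m+k≡m+a = subst (_∈ x) (sym (+-cancelˡ-≡ m k a m+k≡m+a)) a∈x
  covers k k≥1 k≤max | inj₂ m+k∈u = contradiction (∈⇒≤maxW m+k∈u) (<⇒≱ (m<m+n m k≥1))

bump : Color → ℕ → ℕ → ℕ
bump circ   i a = if i ≤ᵇ a then suc a else a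
bump bullet i a = a

psi≡map-bump : ∀ α i L → psi α i L ≡ map (bump α i) L ++ [ i ]
psi≡map-bump circ   i L = refl
psi≡map-bump bullet i L = cong (_++ [ i ]) (sym (map-id L))

≤ᵇ-suc : ∀ m n → (suc m ≤ᵇ suc n) ≡ (m ≤ᵇ n)
≤ᵇ-suc zero    n = refl
≤ᵇ-suc (suc m) n = refl

≤ᵇ-+ : ∀ k m n → (k + m ≤ᵇ k + n) ≡ (m ≤ᵇ n)
≤ᵇ-+ zero    m n = refl
≤ᵇ-+ (suc k) m n = trans (≤ᵇ-suc (k + m) (k + n)) (≤ᵇ-+ k m n)

bump-+ : ∀ α i k a → bump α (i + k) (k + a) ≡ k + bump α i a
bump-+ bullet i k a = refl
bump-+ circ   i k a rewrite +-comm i k | ≤ᵇ-+ k i a with i ≤ᵇ a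
... | true  = sym (+-suc k a)
... | false = refl

bump-below : ∀ α i k a → 1 ≤ i → a ≤ k → bump α (i + k) a ≡ a
bump-below bullet i k a _   _   = refl
bump-below circ   i k a i≥1 a≤k with i + k ≤ᵇ a in eq
... | false = refl
... | true  = contradiction (≤ᵇ⇒≤ (i + k) a (subst T (sym eq) tt)) (<⇒≱ (+-mono-≤ i≥1 a≤k))

psi-⊙ : ∀ α i L u → 1 ≤ i →
  psi α (i + maxW u) (L ⊙ u) ≡ shift (maxW u) (map (bump α i) L) ++ u ++ [ i + maxW u ]
psi-⊙ α i L u i≥1 = begin
  psi α j (shift m L ++ u)                                 ≡⟨ psi≡map-bump α j _ ⟩
  map (bump α j) (shift m L ++ u) ++ [ j ]                 ≡⟨ cong (_++ [ j ]) (map-++ (bump α j) (shift m L) u) ⟩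
  (map (bump α j) (shift m L) ++ map (bump α j) u) ++ [ j ] ≡⟨ cong₂ (λ p q → (p ++ q) ++ [ j ]) bump-shift bump-u ⟩
  (shift m (map (bump α i) L) ++ u) ++ [ j ]               ≡⟨ ++-assoc (shift m (map (bump α i) L)) u [ j ] ⟩
  shift m (map (bump α i) L) ++ u ++ [ j ]                 ∎
  where
  open ≡-Reasoning
  m = maxW u
  j = i + m
  bump-shift : map (bump α j) (shift m L) ≡ shift m (map (bump α i) L)
  bump-shift = trans (sym (map-∘ L)) (trans (map-cong (bump-+ α i m) L) (map-∘ L))
  bump-u : map (bump α j) u ≡ u
  bump-u = map-id-local (All.tabulate (bump-below α i m _ i≥1 ∘ ∈⇒≤maxW))

valid⇒1≤ : ∀ {α i L} → ValidIdx α i L → 1 ≤ i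
valid⇒1≤ {circ}   (i≥1 , _) = i≥1
valid⇒1≤ {bullet} (i≥1 , _) = i≥1

BlueShape : Word → Word → Word → Set
BlueShape u v w = Σ Word λ P → Σ ℕ λ i → v ≡ P ++ [ i ] × w ≡ shift (maxW u) P ++ u ++ [ i + maxW u ]

triB⇒blueShape : ∀ {u v w} → TriB u v w → BlueShape u v w
triB⇒blueShape {u} (α , i , L , _ , valid , refl , refl) =
  map (bump α i) L , i , psi≡map-bump α i L , psi-⊙ α i L u (valid⇒1≤ valid)

-- Only the decomposition v = ψ_{i^α}(v') matters, and any witness of some x ◁_B v provides it.
blueShape⇒triB : ∀ {x t u v w} → TriB x v t → BlueShape u v w → TriB u v w
blueShape⇒triB {u = u} {w = w} (α , i , L , packedL , valid , v≡ , _) (P , j , v≡′ , w≡)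
  with ∷ʳ-injective P (map (bump α i) L) (trans (sym v≡′) (trans v≡ (psi≡map-bump α i L)))
... | refl , refl = α , i , L , packedL , valid , v≡ , trans w≡ (sym (psi-⊙ α i L u (valid⇒1≤ valid)))

blueShape-⊙ : ∀ {x y u v w} → BlueShape x y v → BlueShape u v w → BlueShape (x ⊙ u) y w
blueShape-⊙ {x} {u = u} {w = w} (Q , j , y≡ , v≡) (P , i , v≡′ , w≡)
  with ++-∷ʳ-injective [] P (shift (maxW x) Q) x (trans (sym v≡′) v≡)
... | refl , refl = Q , j , y≡ , (begin
  w                                                    ≡⟨ w≡ ⟩
  shift m (shift k Q ++ x) ++ u ++ [ j + k + m ]       ≡⟨ cong (_++ u ++ [ j + k + m ]) (map-++ (m +_) (shift k Q) x) ⟩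
  (shift m (shift k Q) ++ shift m x) ++ u ++ [ j + k + m ]
    ≡⟨ ++-assoc (shift m (shift k Q)) (shift m x) _ ⟩
  shift m (shift k Q) ++ shift m x ++ u ++ [ j + k + m ] ≡⟨ cong (shift m (shift k Q) ++_) (++-assoc (shift m x) u _) ⟨
  shift m (shift k Q) ++ (x ⊙ u) ++ [ j + k + m ]
    ≡⟨ cong₂ (λ p n → p ++ (x ⊙ u) ++ [ n ]) (shift-shift m k Q) (trans (+-assoc j k m) (cong (j +_) (+-comm k m))) ⟩
  shift (m + k) Q ++ (x ⊙ u) ++ [ j + (m + k) ]        ≡⟨ cong (λ n → shift n Q ++ (x ⊙ u) ++ [ j + n ]) (maxW-⊙ x u) ⟨
  shift (maxW (x ⊙ u)) Q ++ (x ⊙ u) ++ [ j + maxW (x ⊙ u) ] ∎)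
  where
  open ≡-Reasoning
  m = maxW u
  k = maxW x

blueShape-split : ∀ {u v u′ v′ w} → BlueShape u v w → BlueShape u′ v′ w → length u ≤ length u′ →
  Σ Word λ x → u′ ≡ x ⊙ u × BlueShape x v′ v
blueShape-split {u} {v} {u′} (P , i , v≡ , w≡) (P′ , i′ , v′≡ , w≡′) u≤u′
  with ++-∷ʳ-injective (shift (maxW u) P) u (shift (maxW u′) P′) u′ (trans (sym w≡) w≡′)
... | prefixes≡ , lasts≡ with ++-≡-++⁻ (shift (maxW u) P) (shift (maxW u′) P′) u u′ prefixes≡ u≤u′
... | s , u′≡ , shiftP≡ with map-≡-++⁻ (maxW u +_) P (shift (maxW u′) P′) s shiftP≡
... | Q , x , refl , shiftQ≡ , refl = x , u′≡ , P′ , i′ , v′≡ , (begin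
  v                              ≡⟨ v≡ ⟩
  (Q ++ x) ++ [ i ]              ≡⟨ ++-assoc Q x [ i ] ⟩
  Q ++ x ++ [ i ]                ≡⟨ cong₂ (λ q n → q ++ x ++ [ n ]) Q≡ i≡ ⟩
  shift k P′ ++ x ++ [ i′ + k ]  ∎)
  where
  open ≡-Reasoning
  m = maxW u
  k = maxW x
  m′≡ : maxW u′ ≡ m + k
  m′≡ = trans (cong maxW u′≡) (maxW-⊙ x u)
  Q≡ : Q ≡ shift k P′
  Q≡ = shift-injective m (trans shiftQ≡ (trans (cong (λ n → shift n P′) m′≡) (sym (shift-shift m k P′))))
  i≡ : i ≡ i′ + k
  i≡ = +-cancelʳ-≡ m i (i′ + k)
         (trans lasts≡ (trans (cong (i′ +_) (trans m′≡ (+-comm m k))) (sym (+-assoc i′ k m))))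

blueShape-All⁻ˡ : ∀ {Pred : ℕ → Set} {x v′ v} → BlueShape x v′ v → All Pred v → All Pred x
blueShape-All⁻ˡ {x = x} (P , _ , _ , refl) all = All.++⁻ˡ x (All.++⁻ʳ (shift (maxW x) P) all)

blueShape-globalDescent : ∀ {u v w c} → BlueShape u v w → GlobalDescent v c → GlobalDescent w c
blueShape-globalDescent {u} {c = c} (P , i , refl , refl) (c≥1 , c<|v| , descent) =
  c≥1 , ≤-trans (s≤s c≤|mP|) (suc-length≤length-++-∷ʳ (shift m P) u (i + m)) , descent′
  where
  m = maxW u
  c≤|P| : c ≤ length P
  c≤|P| = s≤s⁻¹ (subst (suc c ≤_) (trans (length-++ P) (+-comm (length P) 1)) c<|v|)
  c≤|mP| : c ≤ length (shift m P)
  c≤|mP| = subst (c ≤_) (sym (length-map (m +_) P)) c≤|P|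
  descentP : ∀ a b → a ∈ take c P → b ∈ drop c P ++ [ i ] → b < a
  descentP a b a∈ b∈ = descent a b (subst (a ∈_) (sym (take-++ˡ c P [ i ] c≤|P|)) a∈)
                                   (subst (b ∈_) (sym (drop-++ˡ c P [ i ] c≤|P|)) b∈)
  i<a : ∀ {a} → a ∈ take c P → i < a
  i<a a∈ = descentP _ i a∈ (∈-++⁺ʳ (drop c P) (here refl))
  below : ∀ {a b} → a ∈ take c P → b ∈ shift m (drop c P) ++ u ++ [ i + m ] → b < m + a
  below {a} a∈ b∈ with ∈-++⁻ (shift m (drop c P)) b∈
  ... | inj₁ b∈mP with ∈-map⁻ (m +_) b∈mP
  ...   | b₀ , b₀∈ , refl = +-monoʳ-< m (descentP _ b₀ a∈ (∈-++⁺ˡ b₀∈))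
  below {a} a∈ b∈ | inj₂ b∈u++ with ∈-++⁻ u b∈u++
  ... | inj₁ b∈u         = ≤-<-trans (∈⇒≤maxW b∈u) (m<m+n m (≤-<-trans z≤n (i<a a∈)))
  ... | inj₂ (here refl) = subst (_< m + a) (+-comm m i) (+-monoʳ-< m (i<a a∈))
  descent′ : ∀ a b → a ∈ take c (shift m P ++ u ++ [ i + m ]) → b ∈ drop c (shift m P ++ u ++ [ i + m ]) → b < a
  descent′ a b a∈ b∈
    with ∈-map⁻ (m +_) (subst (a ∈_) (trans (take-++ˡ c (shift m P) _ c≤|mP|) (take-map c P)) a∈)
  ... | a₀ , a₀∈ , refl =
    below a₀∈ (subst (b ∈_) (trans (drop-++ˡ c (shift m P) _ c≤|mP|) (cong (_++ _) (drop-map c P))) b∈)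

blueFactorization⇒blueIrreducible : ∀ {w u v} → Irreducible w → BlueFactorization w u v → BlueIrreducible v
blueFactorization⇒blueIrreducible {w} {u} {v} (_ , noDescent) (packedU , _ , v≢[] , uvw , maximal) =
  (v≢[] , noDescent ∘ map₂ (blueShape-globalDescent shape)) , noLeftFactor
  where
  shape : BlueShape u v w
  shape = triB⇒blueShape uvw
  noLeftFactor : ∀ x y → Packed x → Packed y → y ≢ [] → TriB x y v → x ≡ []
  noLeftFactor x y packedX packedY y≢[] xyv = length-⊙≤⇒≡[] x u
    (maximal (x ⊙ u) y (packed-⊙⁺ packedX packedU) packedY y≢[]
      (blueShape⇒triB xyv (blueShape-⊙ (triB⇒blueShape xyv) shape)))

blueIrreducible⇒blueFactorization : ∀ {w u v} → Packed u → Packed v → v ≢ [] → TriB u v w →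
  BlueIrreducible v → BlueFactorization w u v
blueIrreducible⇒blueFactorization {w} {u} {v} packedU packedV v≢[] uvw (_ , noLeftFactor) =
  packedU , packedV , v≢[] , uvw , maximal
  where
  maximal : ∀ u′ v′ → Packed u′ → Packed v′ → v′ ≢ [] → TriB u′ v′ w → length u′ ≤ length u
  maximal u′ v′ packedU′ packedV′ v′≢[] u′v′w with ≤-total (length u′) (length u)
  ... | inj₁ u′≤u = u′≤u
  ... | inj₂ u≤u′ with blueShape-split (triB⇒blueShape uvw) (triB⇒blueShape u′v′w) u≤u′
  ... | x , refl , xv′v = ≤-reflexive (cong (λ z → length (z ⊙ u)) x≡[])
    where
    packedX : Packed x
    packedX = packed-⊙⁻ˡ (blueShape-All⁻ˡ xv′v (proj₁ packedV)) packedU′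
    x≡[] : x ≡ []
    x≡[] = noLeftFactor x v′ packedX packedV′ v′≢[] (blueShape⇒triB u′v′w xv′v)

mainTheorem10 : (w u v : Word) → Packed w → Irreducible w →
    Packed u → Packed v → v ≢ [] → TriB u v w →
    (BlueFactorization w u v ⇔ BlueIrreducible v)
mainTheorem10 w u v _ irreducibleW packedU packedV v≢[] uvw =
  mk⇔ (blueFactorization⇒blueIrreducible irreducibleW)
      (blueIrreducible⇒blueFactorization packedU packedV v≢[] uvw)
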